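{- Let $h\ge1$ be an integer and $a_p\in F$ with $v_p(a_p)>\lfloor h/p\rfloor$. Then \[T_{\le h}\Big(a_p\big(\lambda_-/\lambda_{++}\big)^h\Big)\in\mathfrak{m}_F[u].\]
   Context: $p$ prime, $F/\mathbb{Q}_p$ finite, $\mathfrak{m}_F$ the maximal ideal of its ring of integers, $v_p(p)=1$. $\lambda_-=\prod_{i\ge0}(1+u^{p^{2i+1}}/p)$ and $\lambda_{++}=\prod_{i\ge1}(1+u^{p^{2i}}/p)$ in $F[\![u]\!]$ (the latter has constant term $1$, hence is invertible). $T_{\le h}(\sum a_iu^i)=\sum_{i\le h}a_iu^i$. -}

module Defs where

open import Level using (Level; suc; _⊔_)
open import Algebra.Bundles using (CommutativeRing)
open import Data.Nat as ℕ using (ℕ; zero; _∸_; _^_)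
open import Data.Nat.Divisibility using (_∣_)
open import Data.Nat.Primality using (Prime; prime⇒nonZero)
open import Data.Integer using (+_)
open import Data.Rational as ℚ using (ℚ; 0ℚ; 1ℚ)
open import Data.Product using (Σ; _×_)
open import Data.Sum using (_⊎_)
open import Data.List using (List; []; _∷_; foldr; map; upTo)
open import Relation.Nullary using (¬_; yes; no)
open import Relation.Binary.PropositionalEquality using (_≡_)

pinv : (p : ℕ) → Prime p → ℚ
pinv p pr = (+ 1 ℚ./ p) {{prime⇒nonZero pr}}

floorDiv : (h p : ℕ) → Prime p → ℚ
floorDiv h p pr = + ((h ℕ./ p) {{prime⇒nonZero pr}}) ℚ./ 1

ℕtoℚ : ℕ → ℚ
ℕtoℚ n = + n ℚ./ 1

-- A field K together with a valuation v (defined on K ∖ {0}, values in ℚ)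
-- and a ring embedding ι : ℚ → K along which v restricts to the p-adic
-- valuation v_p normalised by v_p(p) = 1.  Every finite extension F/ℚ_p
-- (with its valuation normalised by v(p) = 1) is such a structure.
record PValuedField (p : ℕ) (c ℓ : Level) : Set (suc (c ⊔ ℓ)) where
  field
    cring : CommutativeRing c ℓ
  open CommutativeRing cring public
  field
    1≉0     : ¬ (1# ≈ 0#)
    inverse : ∀ x → ¬ (x ≈ 0#) → Σ Carrier (λ y → x * y ≈ 1#)
    ι       : ℚ → Carrier
    ι-+     : ∀ q r → ι (q ℚ.+ r) ≈ ι q + ι r
    ι-*     : ∀ q r → ι (q ℚ.* r) ≈ ι q * ι r
    ι-1     : ι 1ℚ ≈ 1#
    v       : Carrier → ℚ
    v-cong  : ∀ {x y} → x ≈ y → v x ≡ v y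
    v-*     : ∀ x y → ¬ (x ≈ 0#) → ¬ (y ≈ 0#) → v (x * y) ≡ v x ℚ.+ v y
    v-+     : ∀ x y → ¬ (x ≈ 0#) → ¬ (y ≈ 0#) → ¬ ((x + y) ≈ 0#) →
              (v x ℚ.⊓ v y) ℚ.≤ v (x + y)
    v-p     : v (ι (ℕtoℚ p)) ≡ 1ℚ
    v-unit  : ∀ m → ¬ (p ∣ m) → v (ι (ℕtoℚ m)) ≡ 0ℚ

  InMaxIdeal : Carrier → Set ℓ
  InMaxIdeal x = (x ≈ 0#) ⊎ (0ℚ ℚ.< v x)

module PowerSeries {c ℓ : Level} (R : CommutativeRing c ℓ) where
  open CommutativeRing R

  Series : Set c
  Series = ℕ → Carrier

  sumTo : ℕ → (ℕ → Carrier) → Carrier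
  sumTo zero    f = 0#
  sumTo (ℕ.suc n) f = sumTo n f + f n

  _⊛_ : Series → Series → Series
  (f ⊛ g) n = sumTo (ℕ.suc n) (λ k → f k * g (n ∸ k))

  one : Series
  one zero      = 1#
  one (ℕ.suc _) = 0#

  onePlusMono : Carrier → ℕ → Series
  onePlusMono a e n with n ℕ.≟ e
  ... | yes _ = one n + a
  ... | no  _ = one n

  prodTo : ℕ → (ℕ → Series) → Series
  prodTo zero      f = one
  prodTo (ℕ.suc n) f = prodTo n f ⊛ f n

  pow : Series → ℕ → Series
  pow f zero      = one
  pow f (ℕ.suc h) = f ⊛ pow f h

module _ {p : ℕ} {c ℓ : Level} (K : PValuedField p c ℓ) (pr : Prime p) where
  open PValuedField K
  open PowerSeries cring

  -- λ_- = ∏_{i ≥ 0} (1 + u^{p^{2i+1}} / p).  The coefficient of u^n of the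
  -- infinite product is that of the partial product over i < n+1 (the
  -- factors with i > n have p^{2i+1} > n and do not affect it).
  lambdaMinus : Series
  lambdaMinus n = prodTo (ℕ.suc n) (λ i → onePlusMono (ι (pinv p pr)) (p ^ (2 ℕ.* i ℕ.+ 1))) n

  -- λ_{++} = ∏_{i ≥ 1} (1 + u^{p^{2i}} / p), same convention.
  lambdaPlusPlus : Series
  lambdaPlusPlus n = prodTo (ℕ.suc n) (λ i → onePlusMono (ι (pinv p pr)) (p ^ (2 ℕ.* ℕ.suc i))) n

module Submission where

-- Call a power series f over K "d-tame" if every
-- coefficient f n is the image of a rational number and is either zero or
-- has valuation at least -⌊n/d⌋.  Because ⌊k/d⌋ + ⌊(n-k)/d⌋ ≤ ⌊n/d⌋ and the
-- valuation is ultrametric, d-tame series are closed under Cauchy products,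
-- finite products and powers; the series 1 + a u^e is d-tame as soon as
-- v(a) ≥ -1 and e ≥ d, and the inverse of a d-tame series with constant term
-- 1 is d-tame (solve for its coefficients one at a time).  With d = p and
-- a = 1/p this makes λ₋, λ₊₊, λ₊₊⁻¹ and hence (λ₋/λ₊₊)^h p-tame.  The i-th
-- coefficient (i ≤ h) therefore has valuation ≥ -⌊h/p⌋ or vanishes, so
-- multiplying by aₚ with v(aₚ) > ⌊h/p⌋ gives an element of m_F; rationality
-- of the coefficient is what makes "vanishes or not" decidable.

open import Defs
open import Level using (Level)
open import Data.Nat using (ℕ; _≤_)
open import Data.Nat.Primality using (Prime)
open import Data.Rational using (_<_)
open import Data.Product using (_×_)
open import Data.Sum using (_⊎_)
open import Relation.Nullary using (¬_)

import Algebra.Properties.Group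
import Algebra.Properties.Ring as RingProperties
open import Data.Empty using (⊥-elim)
open import Data.Integer as ℤ using (+_)
import Data.Integer.Properties as ℤP
open import Data.Nat as ℕ using (zero; suc; _∸_; _^_; z≤n; s≤s; NonZero)
import Data.Nat.Coprimality as Coprimality
import Data.Nat.DivMod as ℕD
open import Data.Nat.Divisibility using (_∣_; ∣⇒≤)
open import Data.Nat.Induction using (<-rec)
open import Data.Nat.Primality using (prime⇒nonTrivial; prime⇒nonZero)
import Data.Nat.Properties as ℕP
open import Data.Product using (Σ; _,_; proj₂)
open import Data.Rational as ℚ using (ℚ; mkℚ; 0ℚ; 1ℚ)
import Data.Rational.Properties as ℚP
import Data.Rational.Unnormalised as ℚᵘ
import Data.Rational.Unnormalised.Properties as ℚᵘP
open import Data.Sum using (inj₁; inj₂)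
open import Relation.Nullary using (yes; no; Dec)
open import Relation.Nullary.Decidable using (decidable-stable)
open import Relation.Binary.PropositionalEquality as P using (_≡_)

module NatFacts where
  open import Data.Nat using (_/_; _+_; _*_)
  open ℕP using (≤-trans; ≤-reflexive)
  open ℕP.≤-Reasoning

  /-superadditive : ∀ d .{{_ : NonZero d}} a b → a / d + b / d ≤ (a + b) / d
  /-superadditive d a b = begin
    a / d + b / d             ≡⟨ ℕD.m*n/n≡m (a / d + b / d) d ⟨
    (a / d + b / d) * d / d   ≤⟨ ℕD./-monoˡ-≤ d multiples≤ ⟩
    (a + b) / d               ∎
    where
    multiples≤ : (a / d + b / d) * d ≤ a + b
    multiples≤ = begin
      (a / d + b / d) * d     ≡⟨ ℕP.*-distribʳ-+ d (a / d) (b / d) ⟩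
      a / d * d + b / d * d   ≤⟨ ℕP.+-mono-≤ (ℕD.m/n*n≤m a d) (ℕD.m/n*n≤m b d) ⟩
      a + b                   ∎

  /-split : ∀ d .{{_ : NonZero d}} {k n} → k ≤ n → k / d + (n ∸ k) / d ≤ n / d
  /-split d {k} {n} k≤n =
    ≤-trans (/-superadditive d k (n ∸ k)) (≤-reflexive (ℕD./-congˡ (ℕP.m+[n∸m]≡n k≤n)))

  m≤m^k : ∀ m .{{_ : NonZero m}} k → 1 ≤ k → m ≤ m ^ k
  m≤m^k m k 1≤k = begin
    m       ≡⟨ ℕP.^-identityʳ m ⟨
    m ^ 1   ≤⟨ ℕP.^-monoʳ-≤ m 1≤k ⟩
    m ^ k   ∎

open NatFacts

module EmbeddingFacts where
  open Coprimality using (Coprime; 1-coprimeTo)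

  coprimeTo1 : ∀ n → Coprime n 1
  coprimeTo1 n = Coprimality.sym (1-coprimeTo n)

  ℕtoℚ-normal : ∀ n → ℕtoℚ n ≡ mkℚ (+ n) 0 (coprimeTo1 n)
  ℕtoℚ-normal n = ℚP.normalize-coprime (coprimeTo1 n)

  ℕtoℚ-+ : ∀ m n → ℕtoℚ (m ℕ.+ n) ≡ ℕtoℚ m ℚ.+ ℕtoℚ n
  ℕtoℚ-+ m n rewrite ℕtoℚ-normal m | ℕtoℚ-normal n | ℕtoℚ-normal (m ℕ.+ n) =
    ℚP.toℚᵘ-injective
      (ℚᵘP.≃-sym (ℚᵘP.≃-trans (ℚP.toℚᵘ-homo-+ m/1 n/1) (ℚᵘ.*≡* numerators)))
    where
    m/1 = mkℚ (+ m) 0 (coprimeTo1 m)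
    n/1 = mkℚ (+ n) 0 (coprimeTo1 n)
    numerators : (+ m ℤ.* + 1 ℤ.+ + n ℤ.* + 1) ℤ.* + 1 ≡ + (m ℕ.+ n) ℤ.* + 1
    numerators = P.trans (ℤP.*-identityʳ _)
      (P.trans (P.cong₂ ℤ._+_ (ℤP.*-identityʳ (+ m)) (ℤP.*-identityʳ (+ n)))
               (P.sym (ℤP.*-identityʳ (+ (m ℕ.+ n)))))

  ℕtoℚ-mono : ∀ {m n} → m ≤ n → ℕtoℚ m ℚ.≤ ℕtoℚ n
  ℕtoℚ-mono {m} {n} m≤n rewrite ℕtoℚ-normal m | ℕtoℚ-normal n =
    ℚ.*≤* (P.subst₂ ℤ._≤_ (P.sym (ℤP.*-identityʳ (+ m))) (P.sym (ℤP.*-identityʳ (+ n)))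
                        (ℤ.+≤+ m≤n))

  ℕtoℚ-*-pinv : ∀ p (pr : Prime p) → ℕtoℚ p ℚ.* pinv p pr ≡ 1ℚ
  ℕtoℚ-*-pinv (suc k) pr =
    P.trans (P.cong₂ ℚ._*_ (ℕtoℚ-normal (suc k)) pinv-normal)
            (ℚP.*-inverseʳ (mkℚ (+ suc k) 0 (coprimeTo1 (suc k))))
    where
    pinv-normal : pinv (suc k) pr ≡ mkℚ (+ 1) k (1-coprimeTo (suc k))
    pinv-normal = ℚP.normalize-coprime (1-coprimeTo (suc k))

open EmbeddingFacts using (ℕtoℚ-+; ℕtoℚ-mono; ℕtoℚ-*-pinv)

module ValuedField {p : ℕ} (pr : Prime p) {c ℓ : Level} (K : PValuedField p c ℓ) where
  open PValuedField K hiding (zero)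
  open RingProperties ring
    using (x+x≈x⇒x≈0; +-inverseʳ-unique; -0#≈0#; -1*x≈-x; -‿involutive; x≈z//y)
  import Relation.Binary.Reasoning.Setoid setoid as ≈-Reasoning

  ι-0 : ι 0ℚ ≈ 0#
  ι-0 = x+x≈x⇒x≈0 (ι 0ℚ) (sym (ι-+ 0ℚ 0ℚ))

  ι-neg : ∀ q → ι (ℚ.- q) ≈ - ι q
  ι-neg q = +-inverseʳ-unique (ι q) (ι (ℚ.- q))
    (trans (sym (ι-+ q (ℚ.- q))) (trans (reflexive (P.cong ι (ℚP.+-inverseʳ q))) ι-0))

  -- ι is injective at 0 (it is a ring map out of a field into a nonzero ring).
  ι-nonzero : ∀ q → ¬ (q ≡ 0ℚ) → ¬ (ι q ≈ 0#)
  ι-nonzero q q≢0 ιq≈0 = 1≉0 (begin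
    1#                  ≈⟨ ι-1 ⟨
    ι 1ℚ                ≈⟨ reflexive (P.cong ι (P.sym (ℚP.*-inverseʳ q))) ⟩
    ι (q ℚ.* ℚ.1/ q)    ≈⟨ ι-* q (ℚ.1/ q) ⟩
    ι q * ι (ℚ.1/ q)    ≈⟨ *-congʳ ιq≈0 ⟩
    0# * ι (ℚ.1/ q)     ≈⟨ zeroˡ _ ⟩
    0#                  ∎)
    where
    open ≈-Reasoning
    instance _ = ℚ.≢-nonZero q≢0

  nonzero-factors : ∀ {x y} → ¬ (x * y ≈ 0#) → ¬ (x ≈ 0#) × ¬ (y ≈ 0#)
  nonzero-factors {x} {y} xy≉0 =
    (λ x≈0 → xy≉0 (trans (*-congʳ x≈0) (zeroˡ y))) ,
    (λ y≈0 → xy≉0 (trans (*-congˡ y≈0) (zeroʳ x)))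

  -1≉0 : ¬ (- 1# ≈ 0#)
  -1≉0 -1≈0 = 1≉0 (begin
    1#       ≈⟨ -‿involutive 1# ⟨
    - - 1#   ≈⟨ -‿cong -1≈0 ⟩
    - 0#     ≈⟨ -0#≈0# ⟩
    0#       ∎)
    where open ≈-Reasoning

  v-1 : v 1# ≡ 0ℚ
  v-1 = P.trans (v-cong (sym ι-1)) (v-unit 1 p∤1)
    where
    p∤1 : ¬ (p ∣ 1)
    p∤1 p∣1 = ℕP.<⇒≱ (ℕ.nonTrivial⇒n>1 p {{prime⇒nonTrivial pr}}) (∣⇒≤ p∣1)

  -- v(-1) + v(-1) = v(1) = 0, so v(-1) cannot be negative.
  v-neg1 : 0ℚ ℚ.≤ v (- 1#)
  v-neg1 = ℚP.≮⇒≥ {v (- 1#)} {0ℚ} λ v<0 → ℚP.<-irrefl twice≡0 (ℚP.+-mono-< v<0 v<0)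
    where
    twice≡0 : v (- 1#) ℚ.+ v (- 1#) ≡ 0ℚ
    twice≡0 = P.trans (P.sym (v-* _ _ -1≉0 -1≉0))
      (P.trans (v-cong (trans (-1*x≈-x (- 1#)) (-‿involutive 1#))) v-1)

  -- 1/p has valuation -1, because p has valuation 1.
  v-pinv : v (ι (pinv p pr)) ≡ ℚ.- 1ℚ
  v-pinv = inverseʳ-unique 1ℚ (v a) (begin-equality
    1ℚ ℚ.+ v a        ≡⟨ P.cong (ℚ._+ v a) v-p ⟨
    v ιp ℚ.+ v a      ≡⟨ v-* ιp a ιp≉0 a≉0 ⟨
    v (ιp * a)        ≡⟨ v-cong ιp*a≈1 ⟩
    v 1#              ≡⟨ v-1 ⟩
    0ℚ                ∎)
    where
    open Algebra.Properties.Group ℚP.+-0-group using (inverseʳ-unique)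
    open ℚP.≤-Reasoning using (begin-equality_; step-≡-⟨; step-≡-⟩; _∎)
    a ιp : Carrier
    a = ι (pinv p pr)
    ιp = ι (ℕtoℚ p)
    ιp*a≈1 : ιp * a ≈ 1#
    ιp*a≈1 = trans (sym (ι-* _ _)) (trans (reflexive (P.cong ι (ℕtoℚ-*-pinv p pr))) ι-1)
    a≉0 : ¬ (a ≈ 0#)
    a≉0 a≈0 = 1≉0 (trans (sym ιp*a≈1) (trans (*-congˡ a≈0) (zeroʳ ιp)))
    ιp≉0 : ¬ (ιp ≈ 0#)
    ιp≉0 ιp≈0 = 1≉0 (trans (sym ιp*a≈1) (trans (*-congʳ ιp≈0) (zeroˡ a)))

  Rational : Carrier → Set ℓ
  Rational x = Σ ℚ (λ q → x ≈ ι q)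

  Rational-≈0? : ∀ {x} → Rational x → Dec (x ≈ 0#)
  Rational-≈0? {x} (q , x≈ιq) with q ℚP.≟ 0ℚ
  ... | yes P.refl = yes (trans x≈ιq ι-0)
  ... | no q≢0     = no (λ x≈0 → ι-nonzero q q≢0 (trans (sym x≈ιq) x≈0))

  -- Bounded m x: x is zero or v(x) ≥ -m, i.e. x has a pole of order ≤ m.
  -- (A record, so that m can be inferred from the type.)
  record Bounded (m : ℕ) (x : Carrier) : Set ℓ where
    constructor bounded
    field bound : ¬ (x ≈ 0#) → ℚ.- ℕtoℚ m ℚ.≤ v x
  open Bounded

  -- Case split on whether x vanishes.  It is available constructively for
  -- the decidable (hence ¬¬-stable) goals q ≤ r of valuation theory.
  ≤-byCases : ∀ {q r} x → (x ≈ 0# → q ℚ.≤ r) → (¬ (x ≈ 0#) → q ℚ.≤ r) → q ℚ.≤ r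
  ≤-byCases {q} {r} x if-zero if-nonzero =
    decidable-stable (q ℚP.≤? r) (λ q≰r → q≰r (if-nonzero (λ x≈0 → q≰r (if-zero x≈0))))

  Bounded-cong : ∀ {m x y} → x ≈ y → Bounded m x → Bounded m y
  Bounded-cong {m} x≈y bx = bounded λ y≉0 →
    P.subst (ℚ.- ℕtoℚ m ℚ.≤_) (v-cong x≈y) (bound bx (λ x≈0 → y≉0 (trans (sym x≈y) x≈0)))

  Bounded-mono : ∀ {m n x} → m ≤ n → Bounded m x → Bounded n x
  Bounded-mono m≤n bx = bounded λ x≉0 → ℚP.≤-trans (ℚP.neg-antimono-≤ (ℕtoℚ-mono m≤n)) (bound bx x≉0)

  Bounded-0 : ∀ {m} → Bounded m 0#
  Bounded-0 = bounded λ 0≉0 → ⊥-elim (0≉0 refl)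

  Bounded-1 : Bounded 0 1#
  Bounded-1 = bounded λ _ → ℚP.≤-reflexive (P.sym v-1)

  -- The ultrametric inequality.
  Bounded-+ : ∀ {m x y} → Bounded m x → Bounded m y → Bounded m (x + y)
  Bounded-+ {m} {x} {y} bx by = bounded λ x+y≉0 →
    ≤-byCases x (λ x≈0 → bound (Bounded-cong (equals-y x≈0) by) x+y≉0) λ x≉0 →
    ≤-byCases y (λ y≈0 → bound (Bounded-cong (equals-x y≈0) bx) x+y≉0) λ y≉0 →
    ℚP.≤-trans (ℚP.⊓-glb (bound bx x≉0) (bound by y≉0)) (v-+ x y x≉0 y≉0 x+y≉0)
    where
    equals-y : x ≈ 0# → y ≈ x + y
    equals-y x≈0 = sym (trans (+-congʳ x≈0) (+-identityˡ y))
    equals-x : y ≈ 0# → x ≈ x + y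
    equals-x y≈0 = sym (trans (+-congˡ y≈0) (+-identityʳ x))

  Bounded-* : ∀ {m n x y} → Bounded m x → Bounded n y → Bounded (m ℕ.+ n) (x * y)
  Bounded-* {m} {n} {x} {y} bx by = bounded λ xy≉0 →
    let (x≉0 , y≉0) = nonzero-factors xy≉0 in
    P.subst₂ ℚ._≤_ neg-sum (P.sym (v-* x y x≉0 y≉0)) (ℚP.+-mono-≤ (bound bx x≉0) (bound by y≉0))
    where
    neg-sum : ℚ.- ℕtoℚ m ℚ.+ ℚ.- ℕtoℚ n ≡ ℚ.- ℕtoℚ (m ℕ.+ n)
    neg-sum = P.sym (P.trans (P.cong ℚ.-_ (ℕtoℚ-+ m n)) (ℚP.neg-distrib-+ (ℕtoℚ m) (ℕtoℚ n)))

  -- -x = (-1)·x and v(-1) ≥ 0.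
  Bounded-neg : ∀ {m x} → Bounded m x → Bounded m (- x)
  Bounded-neg {m} {x} bx = Bounded-cong (-1*x≈-x x) (bounded λ -1x≉0 →
    let x≉0 = nonzero-factors -1x≉0 .proj₂ in
    P.subst₂ ℚ._≤_ (ℚP.+-identityˡ _) (P.sym (v-* _ _ -1≉0 x≉0)) (ℚP.+-mono-≤ v-neg1 (bound bx x≉0)))

  Admissible : ℕ → Carrier → Set ℓ
  Admissible m x = Rational x × Bounded m x

  Admissible-cong : ∀ {m x y} → x ≈ y → Admissible m x → Admissible m y
  Admissible-cong x≈y ((q , x≈q) , bx) = (q , trans (sym x≈y) x≈q) , Bounded-cong x≈y bx

  Admissible-mono : ∀ {m n x} → m ≤ n → Admissible m x → Admissible n x
  Admissible-mono m≤n (rx , bx) = rx , Bounded-mono m≤n bx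

  Admissible-0 : ∀ {m} → Admissible m 0#
  Admissible-0 = (0ℚ , sym ι-0) , Bounded-0

  Admissible-1 : Admissible 0 1#
  Admissible-1 = (1ℚ , sym ι-1) , Bounded-1

  Admissible-+ : ∀ {m x y} → Admissible m x → Admissible m y → Admissible m (x + y)
  Admissible-+ ((q , x≈q) , bx) ((r , y≈r) , by) =
    (q ℚ.+ r , trans (+-cong x≈q y≈r) (sym (ι-+ q r))) , Bounded-+ bx by

  Admissible-* : ∀ {m n x y} → Admissible m x → Admissible n y → Admissible (m ℕ.+ n) (x * y)
  Admissible-* ((q , x≈q) , bx) ((r , y≈r) , by) =
    (q ℚ.* r , trans (*-cong x≈q y≈r) (sym (ι-* q r))) , Bounded-* bx by

  Admissible-neg : ∀ {m x} → Admissible m x → Admissible m (- x)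
  Admissible-neg ((q , x≈q) , bx) = (ℚ.- q , trans (-‿cong x≈q) (sym (ι-neg q))) , Bounded-neg bx

  Admissible-pinv : Admissible 1 (ι (pinv p pr))
  Admissible-pinv = (pinv p pr , refl) , bounded λ _ → ℚP.≤-reflexive (P.sym v-pinv)

  -- Multiplying an element of pole order ≤ m by a with v(a) > m (or a = 0)
  -- lands in the maximal ideal; deciding whether x vanishes needs rationality.
  Admissible-absorb : ∀ {m a x} → (a ≈ 0#) ⊎ (¬ (a ≈ 0#) × (ℕtoℚ m ℚ.< v a)) →
                      Admissible m x → InMaxIdeal (a * x)
  Admissible-absorb {x = x} (inj₁ a≈0) _ = inj₁ (trans (*-congʳ a≈0) (zeroˡ x))
  Admissible-absorb {m} {a} {x} (inj₂ (a≉0 , m<va)) (rx , bx) with Rational-≈0? rx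
  ... | yes x≈0 = inj₁ (trans (*-congˡ x≈0) (zeroʳ a))
  ... | no x≉0  = inj₂ (P.subst (0ℚ ℚ.<_) (P.sym (v-* a x a≉0 x≉0))
        (P.subst (ℚ._< v a ℚ.+ v x) (ℚP.+-inverseʳ (ℕtoℚ m)) (ℚP.+-mono-<-≤ m<va (bound bx x≉0))))

  open PowerSeries cring

  ⊛-0 : ∀ f g → (f ⊛ g) 0 ≈ f 0 * g 0
  ⊛-0 f g = +-identityˡ (f 0 * g 0)

  prodTo-0 : ∀ N (F : ℕ → Series) → (∀ i → F i 0 ≈ 1#) → prodTo N F 0 ≈ 1#
  prodTo-0 zero    F F0≈1 = refl
  prodTo-0 (suc N) F F0≈1 =
    trans (⊛-0 (prodTo N F) (F N)) (trans (*-cong (prodTo-0 N F F0≈1) (F0≈1 N)) (*-identityˡ 1#))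

  onePlusMono-0 : ∀ a e → 1 ≤ e → onePlusMono a e 0 ≈ 1#
  onePlusMono-0 a e 1≤e with 0 ℕ.≟ e
  ... | yes P.refl = ⊥-elim (ℕP.<⇒≱ 1≤e z≤n)
  ... | no _       = refl

  sumTo-peel : ∀ n (f : ℕ → Carrier) → sumTo (suc n) f ≈ f 0 + sumTo n (λ k → f (suc k))
  sumTo-peel zero    f = trans (+-identityˡ _) (sym (+-identityʳ _))
  sumTo-peel (suc n) f = trans (+-congʳ (sumTo-peel n f)) (+-assoc _ _ _)

  Admissible-sumTo : ∀ {m} N (f : ℕ → Carrier) →
                     (∀ k → k ℕ.< N → Admissible m (f k)) → Admissible m (sumTo N f)
  Admissible-sumTo zero    f adm = Admissible-0
  Admissible-sumTo (suc N) f adm =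
    Admissible-+ (Admissible-sumTo N f (λ k k<N → adm k (ℕP.m<n⇒m<1+n k<N))) (adm N ℕP.≤-refl)

  module TameSeries (d : ℕ) .{{_ : NonZero d}} where

    Tame : Series → Set ℓ
    Tame f = ∀ n → Admissible (n ℕ./ d) (f n)

    Tame-one : Tame one
    Tame-one zero    = Admissible-mono z≤n Admissible-1
    Tame-one (suc n) = Admissible-0

    Tame-⊛ : ∀ {f g} → Tame f → Tame g → Tame (f ⊛ g)
    Tame-⊛ {f} {g} tame-f tame-g n =
      Admissible-sumTo (suc n) (λ k → f k * g (n ∸ k)) λ k k<1+n →
      Admissible-mono (/-split d (ℕP.≤-pred k<1+n)) (Admissible-* (tame-f k) (tame-g (n ∸ k)))

    Tame-prodTo : ∀ N F → (∀ i → Tame (F i)) → Tame (prodTo N F)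
    Tame-prodTo zero    F tame-F = Tame-one
    Tame-prodTo (suc N) F tame-F = Tame-⊛ (Tame-prodTo N F tame-F) (tame-F N)

    Tame-pow : ∀ f h → Tame f → Tame (pow f h)
    Tame-pow f zero    tame-f = Tame-one
    Tame-pow f (suc h) tame-f = Tame-⊛ tame-f (Tame-pow f h tame-f)

    -- 1 + a u^e is tame when v(a) ≥ -1 and e ≥ d, since then ⌊e/d⌋ ≥ 1.
    Tame-onePlusMono : ∀ {a} e → Admissible 1 a → d ≤ e → Tame (onePlusMono a e)
    Tame-onePlusMono e adm-a d≤e n with n ℕ.≟ e
    ... | no _ = Tame-one n
    Tame-onePlusMono (suc e) adm-a d≤e (suc .e) | yes P.refl =
      Admissible-cong (sym (+-identityˡ _)) (Admissible-mono (ℕD.m≥n⇒m/n>0 d≤e) adm-a)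
    Tame-onePlusMono zero adm-a d≤0 .zero | yes P.refl =
      ⊥-elim (ℕP.<⇒≱ (ℕ.>-nonZero⁻¹ d) d≤0)

    -- The inverse μ of a tame series L with L(0) = 1 is tame: the equation
    -- (L ⊛ μ)(n) = one n expresses μ(n) through L and μ(0), …, μ(n-1).
    Tame-inverse : ∀ {L μ} → Tame L → L 0 ≈ 1# → (∀ n → (L ⊛ μ) n ≈ one n) → Tame μ
    Tame-inverse {L} {μ} tame-L L0≈1 Lμ≈one = <-rec _ step
      where
      rest : ℕ → Carrier
      rest n = sumTo n (λ k → L (suc k) * μ (n ∸ suc k))

      μ-solved : ∀ n → μ n ≈ one n - rest n
      μ-solved n = x≈z//y (μ n) (rest n) (one n) (begin
        μ n + rest n                ≈⟨ +-congʳ (*-identityˡ (μ n)) ⟨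
        1# * μ n + rest n           ≈⟨ +-congʳ (*-congʳ L0≈1) ⟨
        L 0 * μ n + rest n          ≈⟨ sumTo-peel n (λ k → L k * μ (n ∸ k)) ⟨
        (L ⊛ μ) n                   ≈⟨ Lμ≈one n ⟩
        one n                       ∎)
        where open ≈-Reasoning

      step : ∀ n → (∀ {m} → m ℕ.< n → Admissible (m ℕ./ d) (μ m)) → Admissible (n ℕ./ d) (μ n)
      step n tame-below = Admissible-cong (sym (μ-solved n))
        (Admissible-+ (Tame-one n) (Admissible-neg (Admissible-sumTo n _ term)))
        where
        term : ∀ k → k ℕ.< n → Admissible (n ℕ./ d) (L (suc k) * μ (n ∸ suc k))
        term k k<n = Admissible-mono (/-split d k<n)
          (Admissible-* (tame-L (suc k)) (tame-below n∸1+k<n))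
          where
          n∸1+k<n : n ∸ suc k ℕ.< n
          n∸1+k<n = ℕP.∸-monoʳ-< {n} {suc k} {0} (s≤s z≤n) k<n

module Lambdas {p : ℕ} (pr : Prime p) {c ℓ : Level} (K : PValuedField p c ℓ) where
  open PValuedField K using (_≈_; 1#; ι)
  open ValuedField pr K
  open PowerSeries (PValuedField.cring K)
  instance
    p≢0 : NonZero p
    p≢0 = prime⇒nonZero pr
  open TameSeries p

  -- The exponents p^(2i+1) and p^(2i+2) are at least p, so every factor
  -- 1 + u^e/p is p-tame.
  Tame-lambdaMinus : Tame (lambdaMinus K pr)
  Tame-lambdaMinus n = Tame-prodTo (suc n) _
    (λ i → Tame-onePlusMono _ Admissible-pinv (m≤m^k p (2 ℕ.* i ℕ.+ 1) (ℕP.m≤n+m 1 (2 ℕ.* i)))) n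

  Tame-lambdaPlusPlus : Tame (lambdaPlusPlus K pr)
  Tame-lambdaPlusPlus n = Tame-prodTo (suc n) _
    (λ i → Tame-onePlusMono _ Admissible-pinv (m≤m^k p (2 ℕ.* suc i) (s≤s z≤n))) n

  lambdaPlusPlus-0 : lambdaPlusPlus K pr 0 ≈ 1#
  lambdaPlusPlus-0 = prodTo-0 1 (λ i → onePlusMono (ι (pinv p pr)) (p ^ (2 ℕ.* suc i))) λ i →
    onePlusMono-0 _ (p ^ (2 ℕ.* suc i)) (ℕP.m^n>0 p (2 ℕ.* suc i))

-- Lemma 5.3: T_{≤h}(aₚ (λ₋/λ₊₊)^h) has coefficients in m_F, where the
-- inverse of λ₊₊ is any μ with λ₊₊ ⊛ μ = 1.  The coefficients of
-- (λ₋ μ)^h are p-tame, and for i ≤ h their pole order ⌊i/p⌋ ≤ ⌊h/p⌋ is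
-- absorbed by aₚ.
lemma5p3 : ∀ {c ℓ : Level} (p : ℕ) (pr : Prime p) (K : PValuedField p c ℓ) →
    let open PValuedField K
        open PowerSeries cring
    in (h : ℕ) → 1 ≤ h →
       (aₚ : Carrier) → ((aₚ ≈ 0#) ⊎ ((¬ (aₚ ≈ 0#)) × (floorDiv h p pr < v aₚ))) →
       (μ : Series) → (∀ n → (lambdaPlusPlus K pr ⊛ μ) n ≈ one n) →
       ∀ i → i ≤ h → InMaxIdeal (aₚ * pow (lambdaMinus K pr ⊛ μ) h i)
lemma5p3 p pr K h _ aₚ aₚ-large μ λ₊₊⊛μ≈1 i i≤h =
  Admissible-absorb aₚ-large (Admissible-mono (ℕD./-monoˡ-≤ p i≤h) (tame-quotient-power i))
  where
  open PowerSeries (PValuedField.cring K)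
  open ValuedField pr K
  open Lambdas pr K
  open TameSeries p

  tame-quotient-power : Tame (pow (lambdaMinus K pr ⊛ μ) h)
  tame-quotient-power = Tame-pow _ h
    (Tame-⊛ Tame-lambdaMinus (Tame-inverse {μ = μ} Tame-lambdaPlusPlus lambdaPlusPlus-0 λ₊₊⊛μ≈1))
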